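{- The poset $\mathcal{T}$ is a dcpo, the map $l\colon\mathcal{H}\to\mathcal{T}$, $l(m,s)=s$, is Scott-continuous, and $\mathcal{T}$ is sober in its Scott topology.
   Context: Let $\mathbb{N}^*$ be the set of finite strings of natural numbers; $\varepsilon$ is the empty string, $n{:}s$ is $s$ with $n$ put in front, $ts$ is concatenation, and for nonempty $t$, $\min(t)$ is its least entry. On $\mathbb{N}\times\mathbb{N}^*$ define, for $m,m',n,n'\in\mathbb{N}$, $s,t\in\mathbb{N}^*$: $(m,n{:}s)<_1(m,n'{:}s)$ if $n<n'$; $(m,ts)<_2(m,s)$ if $t\neq\varepsilon$; $(m,ts)<_3(m',s)$ if $t\ne\varepsilon$ and $\min(t)\le m'$. Let $<\;=\;<_1\cup<_2\cup<_3\cup(<_2;<_1)\cup(<_3;<_1)$ ($x\,(R;R')\,z$ iff $\exists y$, $x\,R\,y$, $y\,R'\,z$) and $\le\;=\;<\cup=$; $\mathcal{H}=(\mathbb{N}\times\mathbb{N}^*,\le)$, a dcpo. On $\mathbb{N}^*$ define $n{:}s\sqsubset_1 n'{:}s$ if $n<n'$, and $ts\sqsubset_2 s$ if $t\ne\varepsilon$; let $\sqsubset\;=\;\sqsubset_1\cup\sqsubset_2\cup(\sqsubset_2;\sqsubset_1)$ and $\sqsubseteq\;=\;\sqsubset\cup=$, a partial order; $\mathcal{T}=(\mathbb{N}^*,\sqsubseteq)$. -}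

module Defs where

open import Level using (Level; 0ℓ) renaming (suc to lsuc)
open import Data.Nat using (ℕ; _<_; _≤_; _⊓_)
open import Data.List using (List; []; _∷_; _++_; foldr)
open import Data.Product using (Σ; ∃; _×_; _,_; proj₁; proj₂)
open import Data.Sum using (_⊎_)
open import Relation.Nullary using (¬_)
open import Relation.Binary.PropositionalEquality using (_≡_; _≢_)
open import Relation.Binary.Structures using (IsPartialOrder)

Str : Set
Str = List ℕ          -- n ∷ s is  n:s ,  t ++ s  is the concatenation ts

min⁺ : ℕ → List ℕ → ℕ
min⁺ k t = foldr _⊓_ k t

Rel : Set → Set₁
Rel A = A → A → Set

_∪ᵣ_ : {A : Set} → Rel A → Rel A → Rel A
(R ∪ᵣ R') x y = R x y ⊎ R' x y

_⨾_ : {A : Set} → Rel A → Rel A → Rel A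
(R ⨾ R') x z = ∃ λ y → R x y × R' y z

Refl-closure : {A : Set} → Rel A → Rel A
Refl-closure R x y = R x y ⊎ x ≡ y

_⊏₁_ : Rel Str
x ⊏₁ y = Σ ℕ λ n → Σ ℕ λ n' → Σ Str λ s →
           n < n' × x ≡ n ∷ s × y ≡ n' ∷ s

_⊏₂_ : Rel Str
x ⊏₂ y = Σ Str λ t → t ≢ [] × x ≡ t ++ y

_⊏_ : Rel Str
_⊏_ = (_⊏₁_ ∪ᵣ _⊏₂_) ∪ᵣ (_⊏₂_ ⨾ _⊏₁_)

_⊑_ : Rel Str
_⊑_ = Refl-closure _⊏_

H : Set
H = ℕ × Str

_<₁_ : Rel H
x <₁ y = Σ ℕ λ m → Σ ℕ λ n → Σ ℕ λ n' → Σ Str λ s →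
           n < n' × x ≡ (m , n ∷ s) × y ≡ (m , n' ∷ s)

_<₂_ : Rel H
x <₂ y = Σ ℕ λ m → Σ Str λ t → Σ Str λ s →
           t ≢ [] × x ≡ (m , t ++ s) × y ≡ (m , s)

-- (m, ts) <₃ (m', s)  if t ≠ ε and min(t) ≤ m'
-- (t nonempty is written k ∷ t', with min(t) = min⁺ k t')
_<₃_ : Rel H
x <₃ y = Σ ℕ λ m → Σ ℕ λ m' → Σ ℕ λ k → Σ Str λ t' → Σ Str λ s →
           min⁺ k t' ≤ m' × x ≡ (m , (k ∷ t') ++ s) × y ≡ (m' , s)

_<H_ : Rel H
_<H_ = ((_<₁_ ∪ᵣ _<₂_) ∪ᵣ _<₃_) ∪ᵣ ((_<₂_ ⨾ _<₁_) ∪ᵣ (_<₃_ ⨾ _<₁_))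

_≤H_ : Rel H
_≤H_ = Refl-closure _<H_

Subset : Set → Set₁
Subset A = A → Set

module Order {A : Set} (_≼_ : Rel A) where

  Directed : Subset A → Set
  Directed D = (∃ λ x → D x)
             × (∀ x y → D x → D y → ∃ λ z → D z × x ≼ z × y ≼ z)

  IsUpperBound : Subset A → A → Set
  IsUpperBound D u = ∀ x → D x → x ≼ u

  IsSup : Subset A → A → Set
  IsSup D u = IsUpperBound D u × (∀ v → IsUpperBound D v → u ≼ v)

  IsDcpo : Set₁
  IsDcpo = IsPartialOrder _≡_ _≼_ × (∀ D → Directed D → ∃ λ u → IsSup D u)

  IsUpperSet : Subset A → Set
  IsUpperSet U = ∀ x y → x ≼ y → U x → U y

  ScottOpen : Subset A → Set₁
  ScottOpen U = IsUpperSet U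
              × (∀ D u → Directed D → IsSup D u → U u → ∃ λ d → D d × U d)

  ScottClosed : Subset A → Set₁
  ScottClosed C = ScottOpen (λ x → ¬ C x)

  closurePt : A → A → Set₁
  closurePt x y = ∀ C → ScottClosed C → C x → C y

  Irreducible : Subset A → Set₁
  Irreducible C = (∃ λ x → C x)
                × (∀ C₁ C₂ → ScottClosed C₁ → ScottClosed C₂ →
                     (∀ x → C x → C₁ x ⊎ C₂ x) →
                     (∀ x → C x → C₁ x) ⊎ (∀ x → C x → C₂ x))

  ScottSober : Set₁
  ScottSober = ∀ C → ScottClosed C → Irreducible C →
                 Σ A λ x → (∀ y → (C y → closurePt x y) × (closurePt x y → C y))
                         × (∀ x' → (∀ y → (C y → closurePt x' y) × (closurePt x' y → C y))
                                  → x' ≡ x)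

ScottContinuous : {A B : Set} (_≼A_ : Rel A) (_≼B_ : Rel B) → (A → B) → Set₁
ScottContinuous _≼A_ _≼B_ f =
  ∀ D u → Order.Directed _≼A_ D → Order.IsSup _≼A_ D u →
    Order.IsSup _≼B_ (λ b → ∃ λ a → D a × f a ≡ b) (f u)

l : H → Str
l (m , s) = s

module Submission where

-- In 𝓣, x ⊑ y holds iff y arises from x by deleting a prefix and then possibly
-- raising the first remaining entry.  Hence the points above any x form a chain,
-- and (classically) every nonempty subset has a least upper bound.  In a dcpo
-- whose principal filters are chains, a Scott-closed irreducible C is the ideal
-- ↓m of the maximal point m = sup (C ∩ ↑x₀), so 𝓣 is sober.
--
-- For continuity of l, let v bound l[D] and take a shortest suffix q of l d₀
-- lying below some l d.  If q = ε then v = ε.  Otherwise q = b ∷ q′, some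
-- l d₁ = k ∷ q′ and no l d lies above q′; so every z ∈ D above d₁ has l z of the
-- same length as l d₁, which forces the first component of z to be that of d₁,
-- and (proj₁ d₁ , v) bounds D.

open import Defs
open import Axiom.DoubleNegationElimination using (DoubleNegationElimination; em⇒dne)
open import Axiom.ExcludedMiddle using (ExcludedMiddle)
open import Data.Empty using (⊥-elim)
open import Data.List using ([]; _∷_; _++_; length)
open import Data.List.Properties using (++-assoc)
open import Data.Nat using (ℕ; suc; _≤_; _<_; z≤n)
open import Data.Nat.Induction using (<-wellFounded)
open import Data.Nat.Properties
open import Data.Product using (Σ; ∃; _×_; _,_; proj₁; proj₂)
open import Data.Sum using (_⊎_; inj₁; inj₂)
import Data.Sum as Sum
open import Induction.WellFounded using (Acc; acc)
open import Level using (0ℓ)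
open import Relation.Binary.PropositionalEquality
open import Relation.Binary.Structures using (IsPartialOrder)
open import Relation.Nullary using (¬_; yes; no)
open import Relation.Nullary.Decidable using (toSum)

pattern by≡ = inj₂ refl
pattern by⊏₁ p = inj₁ (inj₁ (inj₁ p))
pattern by⊏₂ p = inj₁ (inj₁ (inj₂ p))
pattern by⊏₂⊏₁ y p q = inj₁ (inj₂ (y , p , q))

pattern by<₁ p = inj₁ (inj₁ (inj₁ (inj₁ p)))
pattern by<₂ p = inj₁ (inj₁ (inj₁ (inj₂ p)))
pattern by<₃ p = inj₁ (inj₁ (inj₂ p))
pattern by<₂<₁ y p q = inj₁ (inj₂ (inj₁ (y , p , q)))
pattern by<₃<₁ y p q = inj₁ (inj₂ (inj₂ (y , p , q)))

-- The order of 𝓣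

infix 4 _≼_

data _≼_ : Rel Str where
  ε≼ε   : [] ≼ []
  head≤ : ∀ {n k r} → n ≤ k → (n ∷ r) ≼ (k ∷ r)
  cons≼ : ∀ {n r y} → r ≼ y → (n ∷ r) ≼ y

≼-refl : ∀ {x} → x ≼ x
≼-refl {[]}    = ε≼ε
≼-refl {_ ∷ _} = head≤ ≤-refl

≼-top : ∀ x → x ≼ []
≼-top []      = ε≼ε
≼-top (_ ∷ r) = cons≼ (≼-top r)

[]≼⇒≡[] : ∀ {y} → [] ≼ y → y ≡ []
[]≼⇒≡[] ε≼ε = refl

prefix≼ : ∀ t {y x} → y ≼ x → (t ++ y) ≼ x
prefix≼ []      p = p
prefix≼ (_ ∷ t) p = cons≼ (prefix≼ t p)

≼-trans : ∀ {x y z} → x ≼ y → y ≼ z → x ≼ z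
≼-trans ε≼ε         q           = q
≼-trans (head≤ n≤k) (head≤ k≤j) = head≤ (≤-trans n≤k k≤j)
≼-trans (head≤ _)   (cons≼ q)   = cons≼ q
≼-trans (cons≼ p)   q           = cons≼ (≼-trans p q)

≼-length : ∀ {x y} → x ≼ y → length y ≤ length x
≼-length ε≼ε       = z≤n
≼-length (head≤ _) = ≤-refl
≼-length (cons≼ p) = m≤n⇒m≤1+n (≼-length p)

tail⋠cons : ∀ {n r} → ¬ (r ≼ n ∷ r)
tail⋠cons p = <-irrefl refl (≼-length p)

≼-antisym : ∀ {x y} → x ≼ y → y ≼ x → x ≡ y
≼-antisym ε≼ε         _           = refl
≼-antisym (head≤ n≤k) (head≤ k≤n) = cong (_∷ _) (≤-antisym n≤k k≤n)
≼-antisym (head≤ _)   (cons≼ q)   = ⊥-elim (tail⋠cons q)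
≼-antisym (cons≼ p)   q           = ⊥-elim (tail⋠cons (≼-trans p q))

≼-above-total : ∀ {x a b} → x ≼ a → x ≼ b → a ≼ b ⊎ b ≼ a
≼-above-total ε≼ε       ε≼ε       = inj₁ ε≼ε
≼-above-total (head≤ _) (head≤ _) = Sum.map head≤ head≤ (≤-total _ _)
≼-above-total (head≤ _) (cons≼ q) = inj₁ (cons≼ q)
≼-above-total (cons≼ p) (head≤ _) = inj₂ (cons≼ p)
≼-above-total (cons≼ p) (cons≼ q) = ≼-above-total p q

head⊑ : ∀ {n k r} → n ≤ k → (n ∷ r) ⊑ (k ∷ r)
head⊑ n≤k with m≤n⇒m<n∨m≡n n≤k
... | inj₁ n<k  = by⊏₁ (_ , _ , _ , n<k , refl , refl)
... | inj₂ refl = by≡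

cons⊑ : ∀ {n r z} → r ⊑ z → (n ∷ r) ⊑ z
cons⊑ {n} by≡                            = by⊏₂ (n ∷ [] , (λ ()) , refl)
cons⊑ {n} (by⊏₁ r⊏₁z)                    = by⊏₂⊏₁ _ (n ∷ [] , (λ ()) , refl) r⊏₁z
cons⊑ {n} (by⊏₂ (t , _ , refl))          = by⊏₂ (n ∷ t , (λ ()) , refl)
cons⊑ {n} (by⊏₂⊏₁ w (t , _ , refl) w⊏₁z) = by⊏₂⊏₁ w (n ∷ t , (λ ()) , refl) w⊏₁z

≼⇒⊑ : ∀ {x y} → x ≼ y → x ⊑ y
≼⇒⊑ ε≼ε         = by≡
≼⇒⊑ (head≤ n≤k) = head⊑ n≤k
≼⇒⊑ (cons≼ p)   = cons⊑ (≼⇒⊑ p)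

⊑⇒≼ : ∀ {x y} → x ⊑ y → x ≼ y
⊑⇒≼ by≡                                        = ≼-refl
⊑⇒≼ (by⊏₁ (_ , _ , _ , n<k , refl , refl))     = head≤ (<⇒≤ n<k)
⊑⇒≼ (by⊏₂ (t , _ , refl))                      = prefix≼ t ≼-refl
⊑⇒≼ (by⊏₂⊏₁ _ (t , _ , refl) (_ , _ , _ , n<k , refl , refl)) =
  prefix≼ t (head≤ (<⇒≤ n<k))

⊑-top : ∀ x → x ⊑ []
⊑-top x = ≼⇒⊑ (≼-top x)

⊑-trans : ∀ {x y z} → x ⊑ y → y ⊑ z → x ⊑ z
⊑-trans p q = ≼⇒⊑ (≼-trans (⊑⇒≼ p) (⊑⇒≼ q))

⊑-length : ∀ {x y} → x ⊑ y → length y ≤ length x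
⊑-length p = ≼-length (⊑⇒≼ p)

⊑-isPartialOrder : IsPartialOrder _≡_ _⊑_
⊑-isPartialOrder = record
  { isPreorder = record
    { isEquivalence = isEquivalence
    ; reflexive     = λ { refl → by≡ }
    ; trans         = ⊑-trans
    }
  ; antisym = λ p q → ≼-antisym (⊑⇒≼ p) (⊑⇒≼ q)
  }

⊑-above-total : ∀ {x a b} → x ⊑ a → x ⊑ b → a ⊑ b ⊎ b ⊑ a
⊑-above-total p q = Sum.map ≼⇒⊑ ≼⇒⊑ (≼-above-total (⊑⇒≼ p) (⊑⇒≼ q))

cons-⊑-inv : ∀ {n r y} → (n ∷ r) ⊑ y → (∃ λ k → y ≡ k ∷ r) ⊎ r ⊑ y
cons-⊑-inv p with ⊑⇒≼ p
... | head≤ _   = inj₁ (_ , refl)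
... | cons≼ r≼y = inj₂ (≼⇒⊑ r≼y)

module _ (em : ExcludedMiddle 0ℓ) where

  least-satisfying : (P : ℕ → Set) → ∀ {k} → Acc _<_ k → P k →
                     Σ ℕ λ k₀ → P k₀ × (∀ j → P j → k₀ ≤ j)
  least-satisfying P {k} (acc smaller) pk with em {Σ ℕ λ j → j < k × P j}
  ... | yes (j , j<k , pj) = least-satisfying P (smaller j<k) pj
  ... | no ∄j = k , pk , λ j pj → ≮⇒≥ (λ j<k → ∄j (j , j<k , pj))

  least-above : ∀ x (U : Str → Set) → (∀ y → U y → x ≼ y) → Σ Str U →
                Σ Str λ m → U m × (∀ y → U y → m ≼ y)
  least-above [] U above (y , uy) with above y uy
  ... | ε≼ε = [] , uy , above
  least-above (n ∷ r) U above nonempty with em {Σ ℕ λ k → U (k ∷ r)}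
  ... | yes (k , uk) = least-head (least-satisfying (λ j → U (j ∷ r)) (<-wellFounded k) uk)
    where
    least-head : (Σ ℕ λ k₀ → U (k₀ ∷ r) × (∀ j → U (j ∷ r) → k₀ ≤ j)) →
                 Σ Str λ m → U m × (∀ y → U y → m ≼ y)
    least-head (k₀ , uk₀ , k₀-least) = k₀ ∷ r , uk₀ , λ y uy → below y (above y uy) uy
      where
      below : ∀ y → (n ∷ r) ≼ y → U y → (k₀ ∷ r) ≼ y
      below _ (head≤ _)   uy = head≤ (k₀-least _ uy)
      below _ (cons≼ r≼y) _  = cons≼ r≼y
  ... | no ∄k = least-above r U (λ y uy → tail-below y (above y uy) uy) nonempty
    where
    tail-below : ∀ y → (n ∷ r) ≼ y → U y → r ≼ y
    tail-below _ (head≤ _)   uy = ⊥-elim (∄k (_ , uy))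
    tail-below _ (cons≼ r≼y) _  = r≼y

  ⊑-sup : ∀ D → (∃ λ x → D x) → ∃ λ u → Order.IsSup _⊑_ D u
  ⊑-sup D (x , dx) with least-above x (Order.IsUpperBound _⊑_ D)
                          (λ _ ub → ⊑⇒≼ (ub x dx)) ([] , λ y _ → ⊑-top y)
  ... | m , ub , least = m , ub , λ v ubv → ≼⇒⊑ (least v ubv)

-- Sobriety of dcpos whose principal filters are chains

module ScottTopology {A : Set} {_⊴_ : Rel A} (em : ExcludedMiddle 0ℓ) where

  open Order _⊴_

  private
    dne : DoubleNegationElimination 0ℓ
    dne = em⇒dne em

  closed⇒lower : ∀ {C} → ScottClosed C → ∀ {x y} → y ⊴ x → C x → C y
  closed⇒lower (¬C-upper , _) {x} {y} y⊴x cx = dne λ ¬cy → ¬C-upper y x y⊴x ¬cy cx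

  closed⇒sup-closed : ∀ {C} → ScottClosed C → ∀ {D u} → Directed D → IsSup D u →
                      (∀ d → D d → C d) → C u
  closed⇒sup-closed (_ , inaccessible) {D} {u} dir sup D⊆C = dne λ ¬cu →
    let (d , dd , ¬cd) = inaccessible D u dir sup ¬cu in ¬cd (D⊆C d dd)

  lower-sup-closed⇒closed : ∀ {C} → (∀ {x y} → y ⊴ x → C x → C y) →
                            (∀ {D u} → Directed D → IsSup D u → (∀ d → D d → C d) → C u) →
                            ScottClosed C
  lower-sup-closed⇒closed {C} lower sup-closed =
    (λ x y x⊴y ¬cx cy → ¬cx (lower x⊴y cy)) , inaccessible
    where
    inaccessible : ∀ D u → Directed D → IsSup D u → ¬ C u → ∃ λ d → D d × ¬ C d
    inaccessible D u dir sup ¬cu = dne λ ∄d →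
      ¬cu (sup-closed dir sup (λ d dd → dne λ ¬cd → ∄d (d , dd , ¬cd)))

  module _ (po : IsPartialOrder _≡_ _⊴_)
           (sup : ∀ D → Directed D → ∃ λ u → IsSup D u)
           (above-total : ∀ {x a b} → x ⊴ a → x ⊴ b → a ⊴ b ⊎ b ⊴ a) where

    open IsPartialOrder po using () renaming (refl to ⊴-refl; trans to ⊴-trans; antisym to ⊴-antisym)

    ↓-closed : ∀ p → ScottClosed (_⊴ p)
    ↓-closed p = lower-sup-closed⇒closed (λ y⊴x x⊴p → ⊴-trans y⊴x x⊴p)
                                         (λ _ (_ , least) D⊆↓p → least p D⊆↓p)

    closure-⊆-↓ : ∀ {x y} → closurePt x y → y ⊴ x
    closure-⊆-↓ {x} cl = cl (_⊴ x) (↓-closed x) ⊴-refl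

    ↓-⊆-closure : ∀ {x y} → y ⊴ x → closurePt x y
    ↓-⊆-closure y⊴x C closed cx = closed⇒lower closed y⊴x cx

    closed-maximal : ∀ {C x₀} → ScottClosed C → C x₀ →
                     Σ A λ m → C m × (∀ y → C y → m ⊴ y → y ⊴ m)
    closed-maximal {C} {x₀} closed cx₀ = m , cm , λ y cy m⊴y → m-ub y (cy , ⊴-trans x₀⊴m m⊴y)
      where
      S : A → Set
      S y = C y × x₀ ⊴ y
      S-directed : Directed S
      S-directed = (x₀ , cx₀ , ⊴-refl) , λ a b sa sb → larger a b sa sb (above-total (proj₂ sa) (proj₂ sb))
        where
        larger : ∀ a b → S a → S b → a ⊴ b ⊎ b ⊴ a → ∃ λ z → S z × a ⊴ z × b ⊴ z
        larger a b _  sb (inj₁ a⊴b) = b , sb , a⊴b , ⊴-refl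
        larger a b sa _  (inj₂ b⊴a) = a , sa , ⊴-refl , b⊴a
      m = proj₁ (sup S S-directed)
      m-ub = proj₁ (proj₂ (sup S S-directed))
      cm = closed⇒sup-closed closed S-directed (proj₂ (sup S S-directed)) (λ _ → proj₁)
      x₀⊴m = m-ub x₀ (cx₀ , ⊴-refl)

    -- This is where the chain condition enters: a point below both y and m
    -- makes y and m comparable.
    closed-minus-↓maximal : ∀ {C m} → ScottClosed C → (∀ y → C y → m ⊴ y → y ⊴ m) →
                            ScottClosed (λ y → C y × ¬ y ⊴ m)
    closed-minus-↓maximal {C} {m} closed maximal = lower-sup-closed⇒closed lower sup-closed
      where
      lower : ∀ {x y} → y ⊴ x → C x × ¬ x ⊴ m → C y × ¬ y ⊴ m
      lower {x} y⊴x (cx , x⋬m) = closed⇒lower closed y⊴x cx , λ y⊴m →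
        Sum.[ x⋬m , (λ m⊴x → x⋬m (maximal x cx m⊴x)) ] (above-total y⊴x y⊴m)
      sup-closed : ∀ {D u} → Directed D → IsSup D u → (∀ d → D d → C d × ¬ d ⊴ m) →
                   C u × ¬ u ⊴ m
      sup-closed dir@((d₀ , dd₀) , _) sup D⊆ =
        closed⇒sup-closed closed dir sup (λ d dd → proj₁ (D⊆ d dd)) ,
        λ u⊴m → proj₂ (D⊆ d₀ dd₀) (⊴-trans (proj₁ sup d₀ dd₀) u⊴m)

    irreducible-closed-principal : ∀ {C} → ScottClosed C → Irreducible C →
                                   Σ A λ m → ∀ y → (C y → y ⊴ m) × (y ⊴ m → C y)
    irreducible-closed-principal {C} closed ((x₀ , cx₀) , split) with closed-maximal closed cx₀
    ... | m , cm , maximal = m , λ y → C⊆↓m y , λ y⊴m → closed⇒lower closed y⊴m cm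
      where
      C⊆↓m : ∀ y → C y → y ⊴ m
      C⊆↓m with split (_⊴ m) (λ y → C y × ¬ y ⊴ m) (↓-closed m)
                      (closed-minus-↓maximal closed maximal)
                      (λ y cy → Sum.map₂ (cy ,_) (toSum (em {y ⊴ m})))
      ... | inj₁ C⊆↓m = C⊆↓m
      ... | inj₂ C⊆rest = ⊥-elim (proj₂ (C⊆rest m cm) ⊴-refl)

    sober : ScottSober
    sober C closed irreducible with irreducible-closed-principal closed irreducible
    ... | m , C≡↓m = m , represents , unique
      where
      represents : ∀ y → (C y → closurePt m y) × (closurePt m y → C y)
      represents y = (λ cy → ↓-⊆-closure (proj₁ (C≡↓m y) cy)) ,
                     (λ cl → proj₂ (C≡↓m y) (closure-⊆-↓ cl))
      unique : ∀ x′ → (∀ y → (C y → closurePt x′ y) × (closurePt x′ y → C y)) → x′ ≡ m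
      unique x′ C≡cl = ⊴-antisym (proj₁ (C≡↓m x′) (proj₂ (C≡cl x′) (λ _ _ cx′ → cx′)))
                                 (closure-⊆-↓ (proj₁ (C≡cl m) (proj₂ (C≡↓m m) ⊴-refl)))

-- The order of 𝓗 and continuity of l

min⁺≤first : ∀ k t → min⁺ k t ≤ k
min⁺≤first k []      = ≤-refl
min⁺≤first k (a ∷ t) = ≤-trans (m⊓n≤n a _) (min⁺≤first k t)

min⁺-++ : ∀ k t t′ → min⁺ k (t ++ t′) ≤ min⁺ k t
min⁺-++ k []      t′ = min⁺≤first k t′
min⁺-++ k (a ∷ t) t′ = ⊓-monoʳ-≤ a (min⁺-++ k t t′)

infix 4 _≤Hᵛ_

data _≤Hᵛ_ : Rel H where
  same-level     : ∀ {m s x} → s ⊑ x → (m , s) ≤Hᵛ (m , x)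
  prefix-dropped : ∀ {m m′ k t y x} → min⁺ k t ≤ m′ → y ⊑ x →
                   (m , (k ∷ t) ++ y) ≤Hᵛ (m′ , x)

≤H⇒≤Hᵛ : ∀ {a b} → a ≤H b → a ≤Hᵛ b
≤H⇒≤Hᵛ by≡ = same-level by≡
≤H⇒≤Hᵛ (by<₁ (_ , n , n′ , s , n<n′ , refl , refl)) =
  same-level (by⊏₁ (n , n′ , s , n<n′ , refl , refl))
≤H⇒≤Hᵛ (by<₂ (_ , t , _ , t≢ε , refl , refl)) =
  same-level (by⊏₂ (t , t≢ε , refl))
≤H⇒≤Hᵛ (by<₃ (_ , _ , _ , _ , _ , min≤ , refl , refl)) =
  prefix-dropped min≤ by≡
≤H⇒≤Hᵛ (by<₂<₁ _ (_ , t , _ , t≢ε , refl , refl) (_ , n , n′ , s , n<n′ , refl , refl)) =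
  same-level (by⊏₂⊏₁ (n ∷ s) (t , t≢ε , refl) (n , n′ , s , n<n′ , refl , refl))
≤H⇒≤Hᵛ (by<₃<₁ _ (_ , _ , _ , _ , _ , min≤ , refl , refl) (_ , n , n′ , s , n<n′ , refl , refl)) =
  prefix-dropped min≤ (by⊏₁ (n , n′ , s , n<n′ , refl , refl))

same-level⇒≤H : ∀ {m s x} → s ⊑ x → (m , s) ≤H (m , x)
same-level⇒≤H by≡ = by≡
same-level⇒≤H {m} (by⊏₁ (n , n′ , s , n<n′ , refl , refl)) =
  by<₁ (m , n , n′ , s , n<n′ , refl , refl)
same-level⇒≤H {m} (by⊏₂ (t , t≢ε , refl)) =
  by<₂ (m , t , _ , t≢ε , refl , refl)
same-level⇒≤H {m} (by⊏₂⊏₁ _ (t , t≢ε , refl) (n , n′ , s , n<n′ , refl , refl)) =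
  by<₂<₁ (m , n ∷ s) (m , t , n ∷ s , t≢ε , refl , refl) (m , n , n′ , s , n<n′ , refl , refl)

longer-prefix : ∀ {m m′ k} t t′ {y x} → (m , (k ∷ t ++ t′) ++ y) ≤H (m′ , x) →
                (m , (k ∷ t) ++ t′ ++ y) ≤H (m′ , x)
longer-prefix {m} {m′} {k} t t′ {y} {x} = subst (λ s → (m , s) ≤H (m′ , x)) (++-assoc (k ∷ t) t′ y)

drop-then-raise⇒≤H : ∀ {m m′ k t y x} → min⁺ k t ≤ m′ → y ≡ x ⊎ y ⊏₁ x →
                     (m , (k ∷ t) ++ y) ≤H (m′ , x)
drop-then-raise⇒≤H {m} {m′} {k} {t} {x = x} min≤ (inj₁ refl) =
  by<₃ (m , m′ , k , t , x , min≤ , refl , refl)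
drop-then-raise⇒≤H {m} {m′} {k} {t} min≤ (inj₂ (n , n′ , s , n<n′ , refl , refl)) =
  by<₃<₁ (m′ , n ∷ s) (m , m′ , k , t , n ∷ s , min≤ , refl , refl) (m′ , n , n′ , s , n<n′ , refl , refl)

prefix-dropped⇒≤H : ∀ {m m′ k t y x} → min⁺ k t ≤ m′ → y ⊑ x → (m , (k ∷ t) ++ y) ≤H (m′ , x)
prefix-dropped⇒≤H min≤ by≡        = drop-then-raise⇒≤H min≤ (inj₁ refl)
prefix-dropped⇒≤H min≤ (by⊏₁ y⊏₁x) = drop-then-raise⇒≤H min≤ (inj₂ y⊏₁x)
prefix-dropped⇒≤H {k = k} {t} min≤ (by⊏₂ (t′ , _ , refl)) =
  longer-prefix t t′ (drop-then-raise⇒≤H (≤-trans (min⁺-++ k t t′) min≤) (inj₁ refl))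
prefix-dropped⇒≤H {k = k} {t} min≤ (by⊏₂⊏₁ _ (t′ , _ , refl) y⊏₁x) =
  longer-prefix t t′ (drop-then-raise⇒≤H (≤-trans (min⁺-++ k t t′) min≤) (inj₂ y⊏₁x))

≤Hᵛ⇒≤H : ∀ {a b} → a ≤Hᵛ b → a ≤H b
≤Hᵛ⇒≤H (same-level s⊑x)         = same-level⇒≤H s⊑x
≤Hᵛ⇒≤H (prefix-dropped min≤ y⊑x) = prefix-dropped⇒≤H min≤ y⊑x

l-monotone : ∀ {a b} → a ≤H b → l a ⊑ l b
l-monotone a≤b with ≤H⇒≤Hᵛ a≤b
... | same-level s⊑x                   = s⊑x
... | prefix-dropped {k = k} {t} _ y⊑x = ≼⇒⊑ (prefix≼ (k ∷ t) (⊑⇒≼ y⊑x))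

≤H-widen : ∀ {a m x v} → a ≤H (m , x) → x ⊑ v → a ≤H (m , v)
≤H-widen a≤mx x⊑v with ≤H⇒≤Hᵛ a≤mx
... | same-level s⊑x          = ≤Hᵛ⇒≤H (same-level (⊑-trans s⊑x x⊑v))
... | prefix-dropped min≤ y⊑x = ≤Hᵛ⇒≤H (prefix-dropped min≤ (⊑-trans y⊑x x⊑v))

-- Dropping a nonempty prefix strictly shortens the string, so it cannot
-- happen between strings of equal length.
≤H-equal-length⇒same-level : ∀ {m s m′ x} → (m , s) ≤H (m′ , x) → length s ≡ length x → m ≡ m′
≤H-equal-length⇒same-level ms≤m′x |s|≡|x| with ≤H⇒≤Hᵛ ms≤m′x
... | same-level _ = refl
... | prefix-dropped {t = t} {y} {x} _ y⊑x = ⊥-elim (<-irrefl refl (begin-strict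
  length (t ++ y)       <⟨ ≤-refl ⟩
  suc (length (t ++ y)) ≡⟨ |s|≡|x| ⟩
  length x              ≤⟨ ⊑-length y⊑x ⟩
  length y              ≤⟨ ≼-length (prefix≼ t ≼-refl) ⟩
  length (t ++ y)       ∎))
  where open ≤-Reasoning

module _ (em : ExcludedMiddle 0ℓ) {D : Subset H} (D-directed : Order.Directed _≤H_ D)
         {v : Str} (v-bounds-l[D] : ∀ d → D d → l d ⊑ v) where

  stable-level-bounds : ∀ {d₁ k q} → D d₁ → l d₁ ≡ k ∷ q → (∀ d → D d → ¬ q ⊑ l d) →
                        Order.IsUpperBound _≤H_ D (proj₁ d₁ , v)
  stable-level-bounds {d₁} d₁∈D l-d₁≡kq ∄d d d∈D
    with proj₂ D-directed d d₁ d∈D d₁∈D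
  ... | (m , s) , z∈D , d≤z , d₁≤z with cons-⊑-inv (subst (_⊑ s) l-d₁≡kq (l-monotone d₁≤z))
  ...   | inj₂ q⊑s        = ⊥-elim (∄d (m , s) z∈D q⊑s)
  ...   | inj₁ (k′ , refl) = ≤H-widen (subst (λ m′ → d ≤H (m′ , s)) (sym level-stable) d≤z)
                                      (v-bounds-l[D] (m , s) z∈D)
    where
    level-stable : proj₁ d₁ ≡ m
    level-stable = ≤H-equal-length⇒same-level d₁≤z (cong length l-d₁≡kq)

  l-sup-below : ∀ {u} → Order.IsSup _≤H_ D u → ∀ q → (∃ λ d → D d × q ⊑ l d) → l u ⊑ v
  l-sup-below {u} _ [] (d , d∈D , []⊑) =
    subst (l u ⊑_) (sym ([]≼⇒≡[] (⊑⇒≼ (⊑-trans []⊑ (v-bounds-l[D] d d∈D))))) (⊑-top (l u))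
  l-sup-below u-sup (b ∷ q) (d₁ , d₁∈D , bq⊑) with em {∃ λ d → D d × q ⊑ l d}
  ... | yes q-below = l-sup-below u-sup q q-below
  ... | no ∄d with cons-⊑-inv bq⊑
  ...   | inj₂ q⊑ = ⊥-elim (∄d (d₁ , d₁∈D , q⊑))
  ...   | inj₁ (k , l-d₁≡kq) =
    l-monotone (proj₂ u-sup _ (stable-level-bounds d₁∈D l-d₁≡kq λ d d∈D q⊑ → ∄d (d , d∈D , q⊑)))

l-continuous : ExcludedMiddle 0ℓ → ScottContinuous _≤H_ _⊑_ l
l-continuous em D u D-directed u-sup = image-bounded , image-least
  where
  image-bounded : ∀ s → (∃ λ a → D a × l a ≡ s) → s ⊑ l u
  image-bounded _ (a , a∈D , refl) = l-monotone (proj₁ u-sup a a∈D)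
  image-least : ∀ v → (∀ s → (∃ λ a → D a × l a ≡ s) → s ⊑ v) → l u ⊑ v
  image-least v v-bounds =
    let (d₀ , d₀∈D) = proj₁ D-directed in
    l-sup-below em D-directed (λ d d∈D → v-bounds (l d) (d , d∈D , refl)) u-sup
                (l d₀) (d₀ , d₀∈D , by≡)

proposition5p9 : (∀ {ℓ} → ExcludedMiddle ℓ) →
    Order.IsDcpo _⊑_ × ScottContinuous _≤H_ _⊑_ l × Order.ScottSober _⊑_
proposition5p9 em =
  (⊑-isPartialOrder , ⊑-directed-sup) ,
  l-continuous em ,
  ScottTopology.sober em ⊑-isPartialOrder ⊑-directed-sup ⊑-above-total
  where
  ⊑-directed-sup : ∀ D → Order.Directed _⊑_ D → ∃ λ u → Order.IsSup _⊑_ D u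
  ⊑-directed-sup D D-directed = ⊑-sup em D (proj₁ D-directed)
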